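{- Let $q>2$ and let $S$ be a negative orientable sequence of order $n$ over $\mathbb{Z}_q$ of period $m$ that contains the $i$-uniform $n$-tuple $(i,i,\ldots,i)$ for every $i$ with $1\le i<q/2$. Let $S'$ be obtained from $S$ as follows. If $w_q(S)$ is a unit, $S'=S$. If $w_q(S)$ is not a unit and $q\neq 6$, choose $i\in[1,q/2)$ with $w_q(S)-i$ a unit, and delete a single occurrence of $i$ from within an occurrence of $(i,\ldots,i)$ in $S$. If $w_q(S)$ is not a unit and $q=6$ (so $w_6(S)\in\{0,2,3,4\}$): if $w_6(S)\in\{0,2\}$ delete one $1$ from within $(1,\ldots,1)$; if $w_6(S)=3$ delete one $2$ from within $(2,\ldots,2)$; if $w_6(S)=4$ delete one $1$ from within $(1,\ldots,1)$ and one $2$ from within $(2,\ldots,2)$. Then $S'$ is a negative orientable sequence of order $n$ with $w_q(S')$ a unit in $\mathbb{Z}_q$, and its period is at least $m-1$ if $q\neq 6$ and at least $m-2$ if $q=6$.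
   Context: Sequences are periodic with entries in $\mathbb{Z}_q$, described by a ring sequence $[s_0,\ldots,s_{m-1}]$ of one period. For $S=(s_i)$ write $\mathbf{s}_n(i)=(s_i,\ldots,s_{i+n-1})$; for an $n$-tuple $\mathbf{u}=(u_0,\ldots,u_{n-1})$ let $\mathbf{u}^R=(u_{n-1},\ldots,u_0)$ and $-\mathbf{u}=(-u_0,\ldots,-u_{n-1})$. A periodic sequence of period $m$ is an $n$-window sequence if $\mathbf{s}_n(i)=\mathbf{s}_n(j)$ implies $i\equiv j\pmod m$; it is a negative orientable sequence of order $n$ if also $\mathbf{s}_n(i)\neq-\mathbf{s}_n(j)^R$ for all $i,j$. The weight $w(S)$ is $s_0+\cdots+s_{m-1}$ with each $s_i$ viewed as an integer in $[0,q-1]$, and $w_q(S)=w(S)\bmod q$. A unit of $\mathbb{Z}_q$ is $u$ with $\gcd(u,q)=1$. The $i$-uniform $n$-tuple is $(i,i,\ldots,i)$. -}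

module Defs where

open import Data.Nat using (ℕ; zero; suc; _+_; _*_; _∸_; _<_; _≤_; _⊓_; _⊔_; NonZero)
open import Data.Nat.DivMod using (_%_; _mod_)
open import Data.Nat.Coprimality using (Coprime)
open import Data.Fin using (Fin; toℕ)
open import Data.List using (List; []; _∷_; length; map; lookup)
open import Data.Nat.ListAction using (sum)
open import Data.Vec as V using (Vec)
open import Data.Empty using (⊥)
open import Data.Product using (_×_)
open import Data.Sum using (_⊎_)
open import Relation.Binary.PropositionalEquality using (_≡_; _≢_)
open import Relation.Nullary using (¬_)

-- A periodic sequence over ℤ_q is given by its ring sequence (one period),
-- a list of elements of Fin q; its period m is the length of the list.

pos : ∀ {A : Set} → List A → ℕ → ℕ
pos []       j = 0
pos (x ∷ xs) j = j % suc (length xs)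

-- the n-tuple s_n(i) = (s_i, ..., s_{i+n-1}) occurs at i and equals u
-- (indices taken cyclically; nothing occurs in the empty sequence)
OccursAt : ∀ {A : Set} (n : ℕ) → List A → ℕ → Vec A n → Set
OccursAt n []       i u = ⊥
OccursAt n (x ∷ xs) i u =
  V.tabulate (λ k → lookup (x ∷ xs) ((i + toℕ k) mod suc (length xs))) ≡ u

negZ : ∀ {q : ℕ} .{{_ : NonZero q}} → Fin q → Fin q
negZ {q} x = (q ∸ toℕ x) mod q

negRev : ∀ {q n : ℕ} .{{_ : NonZero q}} → Vec (Fin q) n → Vec (Fin q) n
negRev u = V.map negZ (V.reverse u)

IsWindowSeq : ∀ {A : Set} (n : ℕ) → List A → Set
IsWindowSeq n []       = ⊥
IsWindowSeq n (x ∷ xs) =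
  ∀ (i j : ℕ) (u : Vec _ n) → OccursAt n (x ∷ xs) i u → OccursAt n (x ∷ xs) j u →
    pos (x ∷ xs) i ≡ pos (x ∷ xs) j

IsNegOrientable : ∀ {q : ℕ} .{{_ : NonZero q}} (n : ℕ) → List (Fin q) → Set
IsNegOrientable n s =
  IsWindowSeq n s ×
  (∀ (i j : ℕ) (u : Vec _ n) → OccursAt n s i u → ¬ OccursAt n s j (negRev u))

weight : ∀ {q : ℕ} → List (Fin q) → ℕ
weight s = sum (map toℕ s)

IsUnit : (q : ℕ) .{{_ : NonZero q}} → ℕ → Set
IsUnit q a = Coprime (a % q) q

deleteAt : ∀ {A : Set} → ℕ → List A → List A
deleteAt p       []       = []
deleteAt zero    (x ∷ xs) = xs
deleteAt (suc p) (x ∷ xs) = x ∷ deleteAt p xs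

-- Deleting "a single occurrence of i from within an occurrence of (i,...,i)":
-- the occurrence starts at position p, and the deleted entry is its k-th entry (k < n),
-- i.e. position (p + k) mod m of the ring sequence.
data Obtained (q : ℕ) .{{_ : NonZero q}} (n : ℕ) (s : List (Fin q)) : List (Fin q) → Set where
  unit  : IsUnit q (weight s) → Obtained q n s s
  notSix : q ≢ 6 → ¬ IsUnit q (weight s) →
    (i : Fin q) → 1 ≤ toℕ i → 2 * toℕ i < q →
    IsUnit q (weight s % q + (q ∸ toℕ i)) →
    (p k : ℕ) → k < n → OccursAt n s p (V.replicate n i) →
    Obtained q n s (deleteAt (pos s (p + k)) s)
  six02 : q ≡ 6 → (weight s % q ≡ 0 ⊎ weight s % q ≡ 2) →
    (i : Fin q) → toℕ i ≡ 1 →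
    (p k : ℕ) → k < n → OccursAt n s p (V.replicate n i) →
    Obtained q n s (deleteAt (pos s (p + k)) s)
  six3 : q ≡ 6 → weight s % q ≡ 3 →
    (i : Fin q) → toℕ i ≡ 2 →
    (p k : ℕ) → k < n → OccursAt n s p (V.replicate n i) →
    Obtained q n s (deleteAt (pos s (p + k)) s)
  -- delete one 1 (at position d₁) and one 2 (at position d₂) of S:
  -- delete the later position first, then the earlier one
  six4 : q ≡ 6 → weight s % q ≡ 4 →
    (i₁ i₂ : Fin q) → toℕ i₁ ≡ 1 → toℕ i₂ ≡ 2 →
    (p₁ k₁ p₂ k₂ : ℕ) → k₁ < n → k₂ < n →
    OccursAt n s p₁ (V.replicate n i₁) → OccursAt n s p₂ (V.replicate n i₂) →
    Obtained q n s
      (deleteAt (pos s (p₁ + k₁) ⊓ pos s (p₂ + k₂))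
        (deleteAt (pos s (p₁ + k₁) ⊔ pos s (p₂ + k₂)) s))

{-# OPTIONS --safe #-}
-- Deleting one entry c from a run of n copies of c in a negative orientable sequence S gives
-- a sequence S′ each of whose n-windows is an n-window of S, at positions that stay distinct
-- modulo the periods, so window uniqueness and the negative-orientability condition pass from S
-- to S′.  Read cyclically from just after the deleted entry, S′ is S with the last entry of the
-- period dropped, and a window of S′ that wraps around past the gap is the window of S at the
-- same place, or one place later when it starts inside the run.  Deleting c lowers the weight
-- by c, which was chosen to make w_q(S′) a unit; in particular S′ is not empty.  The two
-- deletions made when q = 6 and w₆(S) = 4 come from runs of different symbols, so the run used
-- for the second one survives the first.

module Submission where

open import Defs
open import Data.Nat using (ℕ; _<_; _≤_; _*_; _∸_; NonZero)
open import Data.Fin using (Fin; toℕ)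
open import Data.List using (List; length)
open import Data.Vec using (replicate)
open import Data.Product using (_×_; ∃)
open import Relation.Binary.PropositionalEquality using (_≡_; _≢_)

open import Data.Nat using (zero; suc; _+_; z≤n; s≤s; _<?_; _⊓_; _⊔_; >-nonZero)
open import Data.Nat.Properties
open import Data.Nat.DivMod
open import Data.Nat.Tactic.RingSolver using (solve-∀)
open import Data.Nat.Coprimality using (Coprime; coprime?; 0-coprimeTo-m⇒m≡1)
open import Data.Fin using (fromℕ<; zero; suc)
open import Data.Fin.Properties using (toℕ-fromℕ<; toℕ<n)
open import Data.List using ([]; _∷_; lookup)
open import Data.Vec as V using (Vec)
open import Data.Vec.Properties using (tabulate-cong; lookup∘tabulate; lookup-replicate; tabulate∘lookup)
open import Data.Product using (_,_; proj₁)
open import Data.Sum using (inj₁; inj₂)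
open import Function using (_∘_)
open import Relation.Binary.Definitions using (tri<; tri≈; tri>)
open import Relation.Nullary using (yes; no; contradiction)
open import Relation.Nullary.Decidable using (from-yes)
open import Relation.Binary.PropositionalEquality
  using (refl; sym; trans; cong; cong₂; subst; subst₂; module ≡-Reasoning)
open ≡-Reasoning

private variable
  A : Set
  a c : A
  σ σ′ : ℕ → A
  n P : ℕ

[m%n+o]%n≡[m+o]%n : ∀ m o n .{{_ : NonZero n}} → (m % n + o) % n ≡ (m + o) % n
[m%n+o]%n≡[m+o]%n m o n = begin
  (m % n + o) % n         ≡⟨ %-distribˡ-+ (m % n) o n ⟩
  (m % n % n + o % n) % n ≡⟨ cong (λ x → (x + o % n) % n) (m%n%n≡m%n m n) ⟩
  (m % n + o % n) % n     ≡⟨ %-distribˡ-+ m o n ⟨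
  (m + o) % n             ∎

[n+m]%n≡m%n : ∀ m n .{{_ : NonZero n}} → (n + m) % n ≡ m % n
[n+m]%n≡m%n m n = trans (cong (_% n) (+-comm n m)) ([m+n]%n≡m%n m n)

+-congˡ-mod : ∀ r {i j} n .{{_ : NonZero n}} → i % n ≡ j % n → (r + i) % n ≡ (r + j) % n
+-congˡ-mod r {i} {j} n i≡j = begin
  (r + i) % n           ≡⟨ %-distribˡ-+ r i n ⟩
  (r % n + i % n) % n   ≡⟨ cong (λ x → (r % n + x) % n) i≡j ⟩
  (r % n + j % n) % n   ≡⟨ %-distribˡ-+ r j n ⟨
  (r + j) % n           ∎

+-cancelˡ-mod : ∀ r {i j} n .{{_ : NonZero n}} → (r + i) % n ≡ (r + j) % n → i % n ≡ j % n
+-cancelˡ-mod r {i} {j} n@(suc n-1) r+i≡r+j = begin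
  i % n                        ≡⟨ [m+kn]%n≡m%n i r n ⟨
  (i + r * n) % n              ≡⟨ cong (_% n) (regroup i r n-1) ⟩
  (r + i + r * n-1) % n        ≡⟨ [m%n+o]%n≡[m+o]%n (r + i) (r * n-1) n ⟨
  ((r + i) % n + r * n-1) % n  ≡⟨ cong (λ x → (x + r * n-1) % n) r+i≡r+j ⟩
  ((r + j) % n + r * n-1) % n  ≡⟨ [m%n+o]%n≡[m+o]%n (r + j) (r * n-1) n ⟩
  (r + j + r * n-1) % n        ≡⟨ cong (_% n) (regroup j r n-1) ⟨
  (j + r * n) % n              ≡⟨ [m+kn]%n≡m%n j r n ⟩
  j % n                        ∎
  where
  regroup : ∀ x r k → x + r * suc k ≡ r + x + r * k
  regroup = solve-∀

Periodic : (m : ℕ) .{{_ : NonZero m}} → (ℕ → A) → Set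
Periodic m σ = ∀ {i j} → i % m ≡ j % m → σ i ≡ σ j

periodic-rotate : ∀ {m} r .{{_ : NonZero m}} → Periodic m σ → Periodic m (λ u → σ (r + u))
periodic-rotate {m = m} r periodic = periodic ∘ +-congˡ-mod r m

RunAt : (ℕ → A) → (n P : ℕ) → A → Set
RunAt σ n P c = ∀ {y} → y < n → σ (P + y) ≡ c

run-step : ∀ {R u} → RunAt σ n R c → R ≤ u → suc u < R + n → σ u ≡ σ (suc u)
run-step {σ = σ} {n = n} {c = c} {R = R} run R≤u 1+u<R+n with m≤n⇒∃[o]m+o≡n R≤u
... | y , refl = begin
  σ (R + y)       ≡⟨ run (+-cancelˡ-< R y n (<-trans (n<1+n (R + y)) 1+u<R+n)) ⟩
  c               ≡⟨ run (+-cancelˡ-< R (suc y) n (subst (_< R + n) (sym (+-suc R y)) 1+u<R+n)) ⟨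
  σ (R + suc y)   ≡⟨ cong σ (+-suc R y) ⟩
  σ (suc (R + y)) ∎

-- Lists read cyclically

nth : A → List A → ℕ → A
nth a []       _       = a
nth a (x ∷ xs) zero    = x
nth a (x ∷ xs) (suc i) = nth a xs i

-- The default a is only returned for the empty list.  Opaque, so that unification sees
-- cyc a s j rather than the _%_ term it unfolds to.
opaque
  cyc : A → List A → ℕ → A
  cyc a s j = nth a s (pos s j)

opaque
  unfolding cyc

  cyc≡nth : ∀ (s : List A) {j} → cyc a s j ≡ nth a s (pos s j)
  cyc≡nth _ = refl

pos≡% : ∀ (s : List A) {j} .{{_ : NonZero (length s)}} → pos s j ≡ j % length s
pos≡% (_ ∷ _) = refl

cyc-periodic : ∀ (s : List A) .{{_ : NonZero (length s)}} → Periodic (length s) (cyc a s)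
cyc-periodic {a = a} s {i} {j} i≡j = begin
  cyc a s i          ≡⟨ cyc≡nth s ⟩
  nth a s (pos s i)  ≡⟨ cong (nth a s) (trans (pos≡% s) (trans i≡j (sym (pos≡% s)))) ⟩
  nth a s (pos s j)  ≡⟨ cyc≡nth s ⟨
  cyc a s j          ∎

cyc-< : ∀ (s : List A) {j} .{{_ : NonZero (length s)}} → j < length s → cyc a s j ≡ nth a s j
cyc-< {a = a} s j<m = trans (cyc≡nth s) (cong (nth a s) (trans (pos≡% s) (m<n⇒m%n≡m j<m)))

length-deleteAt : ∀ (s : List A) {d} → d < length s → suc (length (deleteAt d s)) ≡ length s
length-deleteAt (_ ∷ _)  {zero}  _         = refl
length-deleteAt (_ ∷ xs) {suc d} (s≤s d<m) = cong suc (length-deleteAt xs d<m)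

deleteAt-nonZero : ∀ (s : List A) {d} → 2 ≤ length s → d < length s → NonZero (length (deleteAt d s))
deleteAt-nonZero s 2≤m d<m = >-nonZero (≤-pred (subst (2 ≤_) (sym (length-deleteAt s d<m)) 2≤m))

nth-deleteAt-< : ∀ (s : List A) {d j} → j < d → nth a (deleteAt d s) j ≡ nth a s j
nth-deleteAt-< []                        _         = refl
nth-deleteAt-< (_ ∷ _)  {suc d} {zero}  _         = refl
nth-deleteAt-< (_ ∷ xs) {suc d} {suc j} (s≤s j<d) = nth-deleteAt-< xs j<d

nth-deleteAt-≥ : ∀ (s : List A) {d j} → d ≤ j → nth a (deleteAt d s) j ≡ nth a s (suc j)
nth-deleteAt-≥ []                        _         = refl
nth-deleteAt-≥ (_ ∷ _)  {zero}            _         = refl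
nth-deleteAt-≥ (_ ∷ xs) {suc d} {suc j} (s≤s d≤j) = nth-deleteAt-≥ xs d≤j

cyc-deleteAt : ∀ (s : List A) {d u} .{{_ : NonZero (length s)}} .{{_ : NonZero (length (deleteAt d s))}} →
  d < length s → u < length (deleteAt d s) → cyc a (deleteAt d s) (d + u) ≡ cyc a s (suc d + u)
cyc-deleteAt {a = a} s {d} {u} d<m u<M with d + u <? length (deleteAt d s)
... | yes d+u<M = begin
  cyc a (deleteAt d s) (d + u) ≡⟨ cyc-< (deleteAt d s) d+u<M ⟩
  nth a (deleteAt d s) (d + u) ≡⟨ nth-deleteAt-≥ s (m≤m+n d u) ⟩
  nth a s (suc d + u)          ≡⟨ cyc-< s (subst (suc d + u <_) (length-deleteAt s d<m) (s≤s d+u<M)) ⟨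
  cyc a s (suc d + u)          ∎
... | no d+u≮M with m≤n⇒∃[o]m+o≡n (≮⇒≥ d+u≮M)
...   | w , M+w≡d+u = begin
  cyc a (deleteAt d s) (d + u) ≡⟨ cyc-periodic (deleteAt d s) (%-congˡ (sym M+w≡d+u)) ⟩
  cyc a (deleteAt d s) (M + w) ≡⟨ cyc-periodic (deleteAt d s) ([n+m]%n≡m%n w M) ⟩
  cyc a (deleteAt d s) w       ≡⟨ cyc-< (deleteAt d s) (<-≤-trans w<d (≤-pred (subst (d <_) m≡1+M d<m))) ⟩
  nth a (deleteAt d s) w       ≡⟨ nth-deleteAt-< s w<d ⟩
  nth a s w                    ≡⟨ cyc-< s (<-trans w<d d<m) ⟨
  cyc a s w                    ≡⟨ cyc-periodic s ([n+m]%n≡m%n w (length s)) ⟨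
  cyc a s (length s + w)       ≡⟨ cong (cyc a s) (trans (cong (_+ w) m≡1+M) (cong suc M+w≡d+u)) ⟩
  cyc a s (suc d + u)          ∎
  where
  M : ℕ
  M = length (deleteAt d s)
  m≡1+M : length s ≡ suc M
  m≡1+M = sym (length-deleteAt s d<m)
  w<d : w < d
  w<d = +-cancelˡ-< M w d (subst₂ _<_ (sym M+w≡d+u) (+-comm d M) (+-monoʳ-< d u<M))

window : (ℕ → A) → (n : ℕ) → ℕ → Vec A n
window σ n i = V.tabulate (λ k → σ (i + toℕ k))

run⇒window : RunAt σ n P c → window σ n P ≡ replicate n c
run⇒window {c = c} run =
  trans (tabulate-cong λ k → trans (run (toℕ<n k)) (sym (lookup-replicate k c))) (tabulate∘lookup _)

window⇒run : window σ n P ≡ replicate n c → RunAt σ n P c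
window⇒run {σ = σ} {n = n} {P = P} {c = c} σ≡c {y} y<n = begin
  σ (P + y)                    ≡⟨ cong (λ z → σ (P + z)) (toℕ-fromℕ< y<n) ⟨
  σ (P + toℕ k)                ≡⟨ lookup∘tabulate _ k ⟨
  V.lookup (window σ n P) k    ≡⟨ cong (λ v → V.lookup v k) σ≡c ⟩
  V.lookup (replicate n c) k   ≡⟨ lookup-replicate k c ⟩
  c                            ∎
  where
  k : Fin n
  k = fromℕ< y<n

lookup-nth : ∀ (s : List A) (i : Fin (length s)) → lookup s i ≡ nth a s (toℕ i)
lookup-nth (_ ∷ _)  zero    = refl
lookup-nth (_ ∷ xs) (suc i) = lookup-nth xs i

tabulate-lookup≡window : ∀ (x : A) xs {i} →
  V.tabulate (λ k → lookup (x ∷ xs) ((i + toℕ k) mod length (x ∷ xs))) ≡ window (cyc a (x ∷ xs)) n i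
tabulate-lookup≡window {a = a} x xs {i} = tabulate-cong λ k → begin
  lookup (x ∷ xs) ((i + toℕ k) mod m)        ≡⟨ lookup-nth (x ∷ xs) ((i + toℕ k) mod m) ⟩
  nth a (x ∷ xs) (toℕ ((i + toℕ k) mod m))   ≡⟨ cong (nth a (x ∷ xs)) (toℕ-fromℕ< (m%n<n (i + toℕ k) m)) ⟩
  nth a (x ∷ xs) ((i + toℕ k) % m)           ≡⟨ cyc≡nth (x ∷ xs) ⟨
  cyc a (x ∷ xs) (i + toℕ k)                 ∎
  where
  m : ℕ
  m = length (x ∷ xs)

occurs⇒window : ∀ (s : List A) {i u} → OccursAt n s i u → window (cyc a s) n i ≡ u
occurs⇒window (x ∷ xs) occ = trans (sym (tabulate-lookup≡window x xs)) occ

window⇒occurs : ∀ (s : List A) {i u} .{{_ : NonZero (length s)}} → window (cyc a s) n i ≡ u → OccursAt n s i u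
window⇒occurs (x ∷ xs) σ≡u = trans (tabulate-lookup≡window x xs) σ≡u

occurs⇒run : ∀ (s : List A) {p} → OccursAt n s p (replicate n c) → RunAt (cyc a s) n p c
occurs⇒run {a = a} s occ = window⇒run {σ = cyc a s} (occurs⇒window s occ)

occurs⇒nth : ∀ (s : List A) {p k} → OccursAt n s p (replicate n c) → k < n → nth a s (pos s (p + k)) ≡ c
occurs⇒nth s occ k<n = trans (sym (cyc≡nth s)) (occurs⇒run s occ k<n)

run-bound : ∀ (s : List A) → 2 ≤ length s → IsWindowSeq n s → RunAt (cyc a s) n P c → n < length s
run-bound {n = n} {a = a} {P = P} {c = c} s@(_ ∷ _) 2≤m windowSeq run with n <? length s
... | yes n<m = n<m
... | no  n≮m = contradiction 0≡1 λ ()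
  where
  m : ℕ
  m = length s
  run′ : RunAt (cyc a s) n (suc P) c
  run′ {y} _ = begin
    cyc a s (suc P + y)        ≡⟨ cong (cyc a s) (sym (+-suc P y)) ⟩
    cyc a s (P + suc y)        ≡⟨ cyc-periodic s (+-congˡ-mod P m (sym (m%n%n≡m%n (suc y) m))) ⟩
    cyc a s (P + suc y % m)    ≡⟨ run (<-≤-trans (m%n<n (suc y) m) (≮⇒≥ n≮m)) ⟩
    c                          ∎
  P≡1+P : P % m ≡ suc P % m
  P≡1+P = windowSeq P (suc P) (replicate n c)
    (window⇒occurs s (run⇒window {σ = cyc a s} run)) (window⇒occurs s (run⇒window {σ = cyc a s} run′))
  0≡1 : 0 ≡ 1
  0≡1 = begin
    0      ≡⟨ m<n⇒m%n≡m (<-trans (s≤s z≤n) 2≤m) ⟨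
    0 % m  ≡⟨ +-cancelˡ-mod P m (trans (cong (_% m) (+-identityʳ P)) (trans P≡1+P (cong (_% m) (+-comm 1 P)))) ⟩
    1 % m  ≡⟨ m<n⇒m%n≡m 2≤m ⟩
    1      ∎

-- Window embeddings

record WindowEmbedding (n m′ m : ℕ) .{{_ : NonZero m′}} .{{_ : NonZero m}} (σ′ σ : ℕ → A) : Set where
  field
    shift    : ℕ → ℕ
    window-≡ : ∀ j {t} → t < n → σ′ (j + t) ≡ σ (shift j + t)
    reflects : ∀ {i j} → shift i % m ≡ shift j % m → i % m′ ≡ j % m′

infixr 9 _∘ₑ_

_∘ₑ_ : ∀ {m₁ m₂ m₃} {σ₁ σ₂ σ₃ : ℕ → A} .{{_ : NonZero m₁}} .{{_ : NonZero m₂}} .{{_ : NonZero m₃}} →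
  WindowEmbedding n m₂ m₃ σ₂ σ₃ → WindowEmbedding n m₁ m₂ σ₁ σ₂ → WindowEmbedding n m₁ m₃ σ₁ σ₃
g ∘ₑ f = record
  { shift    = G.shift ∘ F.shift
  ; window-≡ = λ j t<n → trans (F.window-≡ j t<n) (G.window-≡ (F.shift j) t<n)
  ; reflects = F.reflects ∘ G.reflects
  }
  where
  module F = WindowEmbedding f
  module G = WindowEmbedding g

rotation : ∀ {m} .{{_ : NonZero m}} r → (∀ u → σ′ u ≡ σ (r + u)) → WindowEmbedding n m m σ′ σ
rotation {σ′ = σ′} {σ = σ} {m = m} r σ′≡σ = record
  { shift    = r +_
  ; window-≡ = λ j {t} _ → trans (σ′≡σ (j + t)) (cong σ (sym (+-assoc r j t)))
  ; reflects = +-cancelˡ-mod r m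
  }

-- r + (r * m ∸ r) = r * m is a full turn.
rotation⁻¹ : ∀ {m} .{{_ : NonZero m}} r → Periodic m σ → WindowEmbedding n m m σ (λ u → σ (r + u))
rotation⁻¹ {m = m} r periodic = rotation (r * m ∸ r) λ u → periodic (begin
  u % m                       ≡⟨ [m+kn]%n≡m%n u r m ⟨
  (u + r * m) % m             ≡⟨ cong (_% m) (+-comm u (r * m)) ⟩
  (r * m + u) % m             ≡⟨ cong (λ x → (x + u) % m) (m+[n∸m]≡n (m≤m*n r m)) ⟨
  (r + (r * m ∸ r) + u) % m   ≡⟨ cong (_% m) (+-assoc r _ u) ⟩
  (r + (r * m ∸ r + u)) % m   ∎)

embed-occurs : ∀ (s′ s : List A) .{{_ : NonZero (length s′)}} .{{_ : NonZero (length s)}} →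
  (ι : WindowEmbedding n (length s′) (length s) (cyc a s′) (cyc a s)) →
  ∀ {i u} → OccursAt n s′ i u → OccursAt n s (WindowEmbedding.shift ι i) u
embed-occurs s′ s ι {i} occ = window⇒occurs s
  (trans (sym (tabulate-cong λ k → window-≡ i (toℕ<n k))) (occurs⇒window s′ occ))
  where open WindowEmbedding ι

embed-negOrientable : ∀ {q} .{{_ : NonZero q}} {a : Fin q} (s′ s : List (Fin q))
  .{{_ : NonZero (length s′)}} .{{_ : NonZero (length s)}} →
  WindowEmbedding n (length s′) (length s) (cyc a s′) (cyc a s) →
  IsNegOrientable n s → IsNegOrientable n s′
embed-negOrientable {n = n} s′@(_ ∷ _) s@(_ ∷ _) ι (windowSeq , ¬negRev) =
  (λ i j u occᵢ occⱼ → reflects {i} {j} (windowSeq (shift i) (shift j) u (occurs occᵢ) (occurs occⱼ))) ,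
  (λ i j u occᵢ occⱼ → ¬negRev (shift i) (shift j) u (occurs occᵢ) (occurs occⱼ))
  where
  open WindowEmbedding ι
  occurs : ∀ {i u} → OccursAt n s′ i u → OccursAt n s (shift i) u
  occurs = embed-occurs s′ s ι

-- Deleting an entry of a run

punchIn : ℕ → ℕ → ℕ
punchIn zero    v       = suc v
punchIn (suc R) zero    = zero
punchIn (suc R) (suc v) = suc (punchIn R v)

punchIn-< : ∀ {R v} → v < R → punchIn R v ≡ v
punchIn-< {suc R} {zero}  _         = refl
punchIn-< {suc R} {suc v} (s≤s v<R) = cong suc (punchIn-< v<R)

punchIn-≥ : ∀ {R v} → R ≤ v → punchIn R v ≡ suc v
punchIn-≥ {zero}          _         = refl
punchIn-≥ {suc R} {suc v} (s≤s R≤v) = cong suc (punchIn-≥ R≤v)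

punchIn-≤ : ∀ R v → punchIn R v ≤ suc v
punchIn-≤ zero    v       = ≤-refl
punchIn-≤ (suc R) zero    = z≤n
punchIn-≤ (suc R) (suc v) = s≤s (punchIn-≤ R v)

punchIn-injective : ∀ R {v w} → punchIn R v ≡ punchIn R w → v ≡ w
punchIn-injective zero    refl = refl
punchIn-injective (suc R) {zero}  {zero}  _  = refl
punchIn-injective (suc R) {suc v} {suc w} eq = cong suc (punchIn-injective R (suc-injective eq))

-- σ′ is σ with the entry at position M, the last of each period, removed; that entry lies in
-- the run R, …, R + n - 1 of c's.  So the window of σ′ at v < M is the window of σ at v with
-- one c of the run shifted out, which is again the window of σ at v if v < R and at v + 1
-- if R ≤ v.
dropLast-embedding : ∀ {M m R} .{{_ : NonZero M}} .{{_ : NonZero m}} → suc M ≡ m →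
  Periodic M σ′ → Periodic m σ → (∀ {u} → u < M → σ′ u ≡ σ u) →
  n < m → R < m → m ≤ R + n → RunAt σ n R c → WindowEmbedding n M m σ′ σ
dropLast-embedding {σ′ = σ′} {σ = σ} {n = n} {M = M} {R = R} refl σ′-periodic σ-periodic agree
  n<m R<m m≤R+n run = record
  { shift    = λ j → punchIn R (j % M)
  ; window-≡ = λ j t<n → trans (σ′-periodic (sym ([m%n+o]%n≡[m+o]%n j _ M))) (window-from (m%n<n j M) t<n)
  ; reflects = λ {i} {j} → punchIn-injective R ∘ punchIn-mod-cancel (m%n<n i M) (m%n<n j M)
  }
  where
  wrap : ∀ {v} → M ≤ v → v < M + M → σ′ v ≡ σ (suc v)
  wrap M≤v v<2M with m≤n⇒∃[o]m+o≡n M≤v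
  ... | w , refl = begin
    σ′ (M + w)   ≡⟨ σ′-periodic ([n+m]%n≡m%n w M) ⟩
    σ′ w         ≡⟨ agree (+-cancelˡ-< M w M v<2M) ⟩
    σ w          ≡⟨ σ-periodic (sym ([n+m]%n≡m%n w (suc M))) ⟩
    σ (suc M + w) ∎

  window-from : ∀ {v t} → v < M → t < n → σ′ (v + t) ≡ σ (punchIn R v + t)
  window-from {v} {t} v<M t<n with R ≤? v | v + t <? M
  ... | yes R≤v | yes v+t<M rewrite punchIn-≥ R≤v =
    trans (agree v+t<M) (run-step {σ = σ} run (≤-trans R≤v (m≤m+n v t)) (≤-trans (s≤s v+t<M) m≤R+n))
  ... | yes R≤v | no  v+t≮M rewrite punchIn-≥ R≤v =
    wrap (≮⇒≥ v+t≮M) (+-mono-< v<M (<-≤-trans t<n (≤-pred n<m)))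
  ... | no  R≰v | yes v+t<M rewrite punchIn-< (≰⇒> R≰v) = agree v+t<M
  ... | no  R≰v | no  v+t≮M rewrite punchIn-< (≰⇒> R≰v) =
    trans (wrap (≮⇒≥ v+t≮M) (+-mono-< v<M (<-≤-trans t<n (≤-pred n<m))))
          (sym (run-step {σ = σ} run (≤-trans (≤-pred R<m) (≮⇒≥ v+t≮M))
                             (subst (_≤ R + n) (cong suc (+-suc v t)) (+-mono-≤ (≰⇒> R≰v) t<n))))

  punchIn-mod-cancel : ∀ {v w} → v < M → w < M →
    punchIn R v % suc M ≡ punchIn R w % suc M → punchIn R v ≡ punchIn R w
  punchIn-mod-cancel v<M w<M eq =
    trans (sym (m<n⇒m%n≡m (s≤s (≤-trans (punchIn-≤ R _) v<M))))
          (trans eq (m<n⇒m%n≡m (s≤s (≤-trans (punchIn-≤ R _) w<M))))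

-- Read cyclically from just after d, s has c at the offsets start, …, start + n - 1; the
-- bounds say that these include the offset length s - 1 of d itself.
record RunThrough (a : A) (s : List A) (n d : ℕ) (c : A) : Set where
  field
    start    : ℕ
    start<m  : start < length s
    covers   : length s ≤ start + n
    run      : RunAt (cyc a s) n (suc d + start) c

runThrough : ∀ (s : List A) {p k} .{{_ : NonZero (length s)}} → n < length s → k < n →
  RunAt (cyc a s) n p c → RunThrough a s n (pos s (p + k)) c
runThrough {n = n} {a = a} {c = c} s@(_ ∷ xs) {p} {k} n<m k<n run
  with m≤n⇒∃[o]m+o≡n (≤-pred (<-trans k<n n<m))
... | r , k+r≡M = record
  { start   = r
  ; start<m = s≤s (subst (r ≤_) k+r≡M (m≤n+m r k))
  ; covers  = subst (_≤ r + n) (trans (+-suc r k) (cong suc (trans (+-comm r k) k+r≡M))) (+-monoʳ-≤ r k<n)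
  ; run     = λ {y} y<n → trans (cyc-periodic s {j = p + y} (around y)) (run y<n)
  }
  where
  m : ℕ
  m = length s
  around : ∀ y → (suc ((p + k) % m) + r + y) % m ≡ (p + y) % m
  around y = begin
    (suc ((p + k) % m) + r + y) % m   ≡⟨ cong (_% m) (regroup₁ ((p + k) % m) r y) ⟩
    ((p + k) % m + suc (r + y)) % m   ≡⟨ [m%n+o]%n≡[m+o]%n (p + k) (suc (r + y)) m ⟩
    (p + k + suc (r + y)) % m         ≡⟨ cong (_% m) (regroup₂ p k r y) ⟩
    (p + y + suc (k + r)) % m         ≡⟨ cong (λ x → (p + y + suc x) % m) k+r≡M ⟩
    (p + y + m) % m                   ≡⟨ [m+n]%n≡m%n (p + y) m ⟩
    (p + y) % m                       ∎
    where
    regroup₁ : ∀ x r y → suc x + r + y ≡ x + suc (r + y)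
    regroup₁ = solve-∀
    regroup₂ : ∀ p k r y → p + k + suc (r + y) ≡ p + y + suc (k + r)
    regroup₂ = solve-∀

outside-wrapping-interval : ∀ {m n R δ} .{{_ : NonZero m}} → R < m → δ < m → m ≤ R + n →
  (∀ {y} → y < n → (R + y) % m ≢ δ % m) → δ < R × R + n ≤ m + δ
outside-wrapping-interval {m} {n} {R} {δ} R<m δ<m m≤R+n misses = δ<R , R+n≤m+δ
  where
  δ<R : δ < R
  δ<R with δ <? R
  ... | yes δ<R = δ<R
  ... | no  δ≮R with m≤n⇒∃[o]m+o≡n (≮⇒≥ δ≮R)
  ...   | y , R+y≡δ = contradiction (cong (_% m) R+y≡δ)
    (misses (+-cancelˡ-< R y n (subst (_< R + n) (sym R+y≡δ) (<-≤-trans δ<m m≤R+n))))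
  R+n≤m+δ : R + n ≤ m + δ
  R+n≤m+δ with R + n ≤? m + δ
  ... | yes R+n≤m+δ = R+n≤m+δ
  ... | no  R+n≰m+δ with m≤n⇒∃[o]m+o≡n (≤-trans (<⇒≤ R<m) (m≤m+n m δ))
  ...   | y , R+y≡m+δ = contradiction (trans (cong (_% m) R+y≡m+δ) ([n+m]%n≡m%n δ m))
    (misses (+-cancelˡ-< R y n (subst (_< R + n) (sym R+y≡m+δ) (≰⇒> R+n≰m+δ))))

runThrough-deleteAt : ∀ (s : List A) {d e} .{{_ : NonZero (length s)}} .{{_ : NonZero (length (deleteAt e s))}} →
  d < e → e < length s → nth a s e ≢ c → RunThrough a s n d c → RunThrough a (deleteAt e s) n d c
runThrough-deleteAt {A = A} {a = a} {c = c} {n = n} s {d} d<e e<m nth≢c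
  record { start = R ; start<m = R<m ; covers = m≤R+n ; run = run }
  with m≤n⇒∃[o]m+o≡n d<e
... | δ , refl with outside-wrapping-interval R<m (≤-<-trans (m≤n+m δ (suc d)) e<m) m≤R+n misses
  where
  misses : ∀ {y} → y < n → (R + y) % length s ≢ δ % length s
  misses {y} y<n R+y≡δ = nth≢c (begin
    nth a s (suc d + δ)        ≡⟨ cyc-< s e<m ⟨
    cyc a s (suc d + δ)        ≡⟨ cyc-periodic s (+-congˡ-mod (suc d) (length s) (sym R+y≡δ)) ⟩
    cyc a s (suc d + (R + y))  ≡⟨ cong (cyc a s) (sym (+-assoc (suc d) R y)) ⟩
    cyc a s (suc d + R + y)    ≡⟨ run y<n ⟩
    c                          ∎)
... | δ<R , R+n≤m+δ with m≤n⇒∃[o]m+o≡n δ<R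
... | w , refl = record
  { start   = δ + w
  ; start<m = ≤-pred (subst (suc (δ + w) <_) m≡1+M R<m)
  ; covers  = ≤-pred (subst (_≤ suc δ + w + n) m≡1+M m≤R+n)
  ; run     = run′
  }
  where
  s′ : List A
  s′ = deleteAt (suc d + δ) s
  M : ℕ
  M = length s′
  m≡1+M : length s ≡ suc M
  m≡1+M = sym (length-deleteAt s e<m)
  w+n≤M : w + n ≤ M
  w+n≤M = +-cancelˡ-≤ δ (w + n) M (subst₂ _≤_ (+-assoc δ w n) (+-comm M δ)
    (≤-pred (subst (suc δ + w + n ≤_) (cong (_+ δ) m≡1+M) R+n≤m+δ)))
  run′ : RunAt (cyc a s′) n (suc d + (δ + w)) c
  run′ {y} y<n = begin
    cyc a s′ (suc d + (δ + w) + y)       ≡⟨ cong (cyc a s′) (regroup₁ d δ w y) ⟩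
    cyc a s′ (suc d + δ + (w + y))       ≡⟨ cyc-deleteAt s e<m (<-≤-trans (+-monoʳ-< w y<n) w+n≤M) ⟩
    cyc a s (suc (suc d + δ) + (w + y))  ≡⟨ cong (cyc a s) (regroup₂ d δ w y) ⟩
    cyc a s (suc d + suc (δ + w) + y)    ≡⟨ run y<n ⟩
    c                                    ∎
    where
    regroup₁ : ∀ d δ w y → suc d + (δ + w) + y ≡ suc d + δ + (w + y)
    regroup₁ = solve-∀
    regroup₂ : ∀ d δ w y → suc (suc d + δ) + (w + y) ≡ suc d + suc (δ + w) + y
    regroup₂ = solve-∀

deleteAt-embedding : ∀ (s : List A) {d} .{{_ : NonZero (length s)}} .{{_ : NonZero (length (deleteAt d s))}} →
  d < length s → n < length s → RunThrough a s n d c →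
  WindowEmbedding n (length (deleteAt d s)) (length s) (cyc a (deleteAt d s)) (cyc a s)
deleteAt-embedding {n = n} {a = a} {c = c} s {d} d<m n<m r =
  rotation (suc d) (λ _ → refl)
  ∘ₑ dropLast-embedding (length-deleteAt s d<m)
       (periodic-rotate d (cyc-periodic (deleteAt d s))) (periodic-rotate (suc d) (cyc-periodic s))
       (cyc-deleteAt s d<m) n<m start<m covers run′
  ∘ₑ rotation⁻¹ d (cyc-periodic (deleteAt d s))
  where
  open RunThrough r
  run′ : RunAt (λ u → cyc a s (suc d + u)) n start c
  run′ {y} y<n = trans (cong (cyc a s) (sym (+-assoc (suc d) start y))) (run y<n)

deleteAt-negOrientable : ∀ {q} .{{_ : NonZero q}} {a c : Fin q} (s : List (Fin q)) {d} →
  2 ≤ length s → d < length s → RunThrough a s n d c → IsNegOrientable n s → IsNegOrientable n (deleteAt d s)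
deleteAt-negOrientable {n = n} s@(_ ∷ _) {d} 2≤m d<m r negOrientable =
  embed-negOrientable (deleteAt d s) s (deleteAt-embedding s d<m n<m r) negOrientable
  where
  instance
    M≢0 : NonZero (length (deleteAt d s))
    M≢0 = deleteAt-nonZero s 2≤m d<m
  n<m : n < length s
  n<m = run-bound s 2≤m (proj₁ negOrientable) (RunThrough.run r)

deleteAt²-negOrientable : ∀ {q} .{{_ : NonZero q}} {a c c′ : Fin q} (s : List (Fin q)) {d e} →
  3 ≤ length s → d < e → e < length s → nth a s e ≢ c → RunThrough a s n d c → RunThrough a s n e c′ →
  IsNegOrientable n s → IsNegOrientable n (deleteAt d (deleteAt e s))
deleteAt²-negOrientable s@(_ ∷ _) {d} {e} 3≤m d<e e<m nth≢c r r′ negOrientable =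
  deleteAt-negOrientable (deleteAt e s) 2≤M (<-≤-trans d<e (≤-pred (subst (e <_) m≡1+M e<m)))
    (runThrough-deleteAt s d<e e<m nth≢c r)
    (deleteAt-negOrientable s 2≤m e<m r′ negOrientable)
  where
  2≤m : 2 ≤ length s
  2≤m = ≤-trans (n≤1+n 2) 3≤m
  instance
    M≢0 : NonZero (length (deleteAt e s))
    M≢0 = deleteAt-nonZero s 2≤m e<m
  m≡1+M : length s ≡ suc (length (deleteAt e s))
  m≡1+M = sym (length-deleteAt s e<m)
  2≤M : 2 ≤ length (deleteAt e s)
  2≤M = ≤-pred (subst (3 ≤_) m≡1+M 3≤m)

weight-deleteAt : ∀ {q} {a : Fin q} (s : List (Fin q)) {d} → d < length s →
  weight (deleteAt d s) + toℕ (nth a s d) ≡ weight s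
weight-deleteAt (x ∷ s) {zero}  _         = +-comm (weight s) (toℕ x)
weight-deleteAt (x ∷ s) {suc d} (s≤s d<m) =
  trans (+-assoc (toℕ x) _ _) (cong (toℕ x +_) (weight-deleteAt s d<m))

isUnit-∸ : ∀ {q} .{{_ : NonZero q}} {w w′ i} → w′ + i ≡ w → i ≤ q →
  IsUnit q (w % q + (q ∸ i)) → IsUnit q w′
isUnit-∸ {q} {w′ = w′} {i} refl i≤q = subst (λ r → Coprime r q) (begin
  ((w′ + i) % q + (q ∸ i)) % q  ≡⟨ [m%n+o]%n≡[m+o]%n (w′ + i) (q ∸ i) q ⟩
  (w′ + i + (q ∸ i)) % q        ≡⟨ cong (_% q) (+-assoc w′ i (q ∸ i)) ⟩
  (w′ + (i + (q ∸ i))) % q      ≡⟨ cong (λ x → (w′ + x) % q) (m+[n∸m]≡n i≤q) ⟩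
  (w′ + q) % q                  ≡⟨ [m+n]%n≡m%n w′ q ⟩
  w′ % q                        ∎)

isUnit-residue : ∀ {q} .{{_ : NonZero q}} {x r i j} → x ≡ r → i ≡ j →
  IsUnit q (r + (q ∸ j)) → IsUnit q (x + (q ∸ i))
isUnit-residue refl refl u = u

isUnit⇒nonempty : ∀ {q} .{{_ : NonZero q}} (s : List (Fin q)) → 1 < q → IsUnit q (weight s) → 0 < length s
isUnit⇒nonempty {q} []      1<q u = contradiction
  (0-coprimeTo-m⇒m≡1 (subst (λ r → Coprime r q) (m<n⇒m%n≡m (<-trans (s≤s z≤n) 1<q)) u)) (>⇒≢ 1<q)
isUnit⇒nonempty     (_ ∷ _) _   _    = s≤s z≤n

Outcome : (q : ℕ) .{{_ : NonZero q}} (n : ℕ) (s s′ : List (Fin q)) → Set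
Outcome q n s s′ = IsNegOrientable n s′ × IsUnit q (weight s′) ×
  (q ≢ 6 → length s ∸ 1 ≤ length s′) × (q ≡ 6 → length s ∸ 2 ≤ length s′)

deleteOne : ∀ {q} .{{_ : NonZero q}} {n p k} {c : Fin q} (s : List (Fin q)) → 1 < q →
  IsNegOrientable n s → OccursAt n s p (replicate n c) → k < n → IsUnit q (weight s % q + (q ∸ toℕ c)) →
  Outcome q n s (deleteAt (pos s (p + k)) s)
deleteOne {q} {n} {p} {k} {c} s@(_ ∷ _) 1<q negOrientable occ k<n u =
  deleteAt-negOrientable s 2≤m d<m (runThrough s n<m k<n run) negOrientable ,
  unit′ , (λ _ → m-1≤M) , (λ _ → ≤-trans (∸-monoʳ-≤ (length s) (n≤1+n 1)) m-1≤M)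
  where
  d : ℕ
  d = pos s (p + k)
  run : RunAt (cyc c s) n p c
  run = occurs⇒run s occ
  d<m : d < length s
  d<m = m%n<n (p + k) (length s)
  unit′ : IsUnit q (weight (deleteAt d s))
  unit′ = isUnit-∸ weight′ (<⇒≤ (toℕ<n c)) u
    where
    weight′ : weight (deleteAt d s) + toℕ c ≡ weight s
    weight′ = subst (λ x → weight (deleteAt d s) + toℕ x ≡ weight s) (occurs⇒nth {a = c} s {p} occ k<n)
                    (weight-deleteAt s d<m)
  m≡1+M : length s ≡ suc (length (deleteAt d s))
  m≡1+M = sym (length-deleteAt s d<m)
  m-1≤M : length s ∸ 1 ≤ length (deleteAt d s)
  m-1≤M = ≤-reflexive (cong (_∸ 1) m≡1+M)
  2≤m : 2 ≤ length s
  2≤m = subst (2 ≤_) (sym m≡1+M) (s≤s (isUnit⇒nonempty (deleteAt d s) 1<q unit′))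
  n<m : n < length s
  n<m = run-bound s 2≤m (proj₁ negOrientable) run

deleteTwo-< : ∀ {q} .{{_ : NonZero q}} {n p p′ k k′} {c c′ : Fin q} (s : List (Fin q)) → 1 < q →
  IsNegOrientable n s → c ≢ c′ → OccursAt n s p (replicate n c) → OccursAt n s p′ (replicate n c′) →
  k < n → k′ < n → pos s (p + k) < pos s (p′ + k′) →
  toℕ c + toℕ c′ ≤ q → IsUnit q (weight s % q + (q ∸ (toℕ c + toℕ c′))) →
  let s″ = deleteAt (pos s (p + k)) (deleteAt (pos s (p′ + k′)) s) in
  IsNegOrientable n s″ × IsUnit q (weight s″) × length s ∸ 2 ≤ length s″
deleteTwo-< {q} {n} {p} {p′} {k} {k′} {c} {c′} s@(_ ∷ _) 1<q negOrientable c≢c′ occ occ′ k<n k′<n d<e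
  c+c′≤q u =
  deleteAt²-negOrientable s 3≤m d<e e<m (λ nth≡c → c≢c′ (trans (sym nth≡c) deleted′))
    (runThrough s n<m k<n run) (runThrough s n<m k′<n run′) negOrientable ,
  u″ , ≤-reflexive (cong (_∸ 2) m≡2+M)
  where
  d e : ℕ
  d = pos s (p + k)
  e = pos s (p′ + k′)
  s′ s″ : List (Fin q)
  s′ = deleteAt e s
  s″ = deleteAt d s′
  run : RunAt (cyc c s) n p c
  run = occurs⇒run s occ
  run′ : RunAt (cyc c s) n p′ c′
  run′ = occurs⇒run s occ′
  deleted′ : nth c s e ≡ c′
  deleted′ = occurs⇒nth s {p′} occ′ k′<n
  e<m : e < length s
  e<m = m%n<n (p′ + k′) (length s)
  m≡1+M′ : length s ≡ suc (length s′)
  m≡1+M′ = sym (length-deleteAt s e<m)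
  d<M′ : d < length s′
  d<M′ = <-≤-trans d<e (≤-pred (subst (e <_) m≡1+M′ e<m))
  m≡2+M : length s ≡ suc (suc (length s″))
  m≡2+M = trans m≡1+M′ (cong suc (sym (length-deleteAt s′ d<M′)))
  weight″ : weight s″ + (toℕ c + toℕ c′) ≡ weight s
  weight″ = begin
    weight s″ + (toℕ c + toℕ c′)           ≡⟨ +-assoc (weight s″) (toℕ c) (toℕ c′) ⟨
    weight s″ + toℕ c + toℕ c′             ≡⟨ cong (λ x → weight s″ + toℕ x + toℕ c′) deleted ⟨
    weight s″ + toℕ (nth c s′ d) + toℕ c′  ≡⟨ cong (_+ toℕ c′) (weight-deleteAt s′ d<M′) ⟩
    weight s′ + toℕ c′                     ≡⟨ cong (λ x → weight s′ + toℕ x) deleted′ ⟨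
    weight s′ + toℕ (nth c s e)            ≡⟨ weight-deleteAt s e<m ⟩
    weight s                               ∎
    where
    deleted : nth c s′ d ≡ c
    deleted = trans (nth-deleteAt-< s d<e) (occurs⇒nth s {p} occ k<n)
  u″ : IsUnit q (weight s″)
  u″ = isUnit-∸ weight″ c+c′≤q u
  3≤m : 3 ≤ length s
  3≤m = subst (3 ≤_) (sym m≡2+M) (s≤s (s≤s (isUnit⇒nonempty s″ 1<q u″)))
  n<m : n < length s
  n<m = run-bound s (≤-trans (n≤1+n 2) 3≤m) (proj₁ negOrientable) run

deleteTwo : ∀ {q} .{{_ : NonZero q}} {n p₁ p₂ k₁ k₂} {c₁ c₂ : Fin q} (s : List (Fin q)) → 1 < q →
  IsNegOrientable n s → c₁ ≢ c₂ → OccursAt n s p₁ (replicate n c₁) → OccursAt n s p₂ (replicate n c₂) →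
  k₁ < n → k₂ < n → toℕ c₁ + toℕ c₂ ≤ q → IsUnit q (weight s % q + (q ∸ (toℕ c₁ + toℕ c₂))) →
  let d₁ = pos s (p₁ + k₁) ; d₂ = pos s (p₂ + k₂) ; s″ = deleteAt (d₁ ⊓ d₂) (deleteAt (d₁ ⊔ d₂) s) in
  IsNegOrientable n s″ × IsUnit q (weight s″) × length s ∸ 2 ≤ length s″
deleteTwo {q} {n} {p₁} {p₂} {k₁} {k₂} {c₁} {c₂} s 1<q negOrientable c₁≢c₂ occ₁ occ₂ k₁<n k₂<n c₁+c₂≤q u
  with <-cmp (pos s (p₁ + k₁)) (pos s (p₂ + k₂))
... | tri< d₁<d₂ _ _ rewrite m≤n⇒m⊓n≡m (<⇒≤ d₁<d₂) | m≤n⇒m⊔n≡n (<⇒≤ d₁<d₂) =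
  deleteTwo-< s 1<q negOrientable c₁≢c₂ occ₁ occ₂ k₁<n k₂<n d₁<d₂ c₁+c₂≤q u
... | tri> _ _ d₂<d₁ rewrite m≥n⇒m⊓n≡n (<⇒≤ d₂<d₁) | m≥n⇒m⊔n≡m (<⇒≤ d₂<d₁) =
  deleteTwo-< s 1<q negOrientable (c₁≢c₂ ∘ sym) occ₂ occ₁ k₂<n k₁<n d₂<d₁
    (subst (_≤ q) c₁+c₂≡c₂+c₁ c₁+c₂≤q) (subst (λ x → IsUnit q (weight s % q + (q ∸ x))) c₁+c₂≡c₂+c₁ u)
  where
  c₁+c₂≡c₂+c₁ : toℕ c₁ + toℕ c₂ ≡ toℕ c₂ + toℕ c₁
  c₁+c₂≡c₂+c₁ = +-comm (toℕ c₁) (toℕ c₂)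
... | tri≈ _ d₁≡d₂ _ = contradiction (begin
  c₁                          ≡⟨ occurs⇒nth s {p₁} occ₁ k₁<n ⟨
  nth c₁ s (pos s (p₁ + k₁))  ≡⟨ cong (nth c₁ s) d₁≡d₂ ⟩
  nth c₁ s (pos s (p₂ + k₂))  ≡⟨ occurs⇒nth s {p₂} occ₂ k₂<n ⟩
  c₂                          ∎) c₁≢c₂

deleteOneAndTwo : ∀ {n p₁ p₂ k₁ k₂} {i₁ i₂ : Fin 6} (s : List (Fin 6)) → IsNegOrientable n s →
  weight s % 6 ≡ 4 → toℕ i₁ ≡ 1 → toℕ i₂ ≡ 2 →
  OccursAt n s p₁ (replicate n i₁) → OccursAt n s p₂ (replicate n i₂) → k₁ < n → k₂ < n →
  Outcome 6 n s (deleteAt (pos s (p₁ + k₁) ⊓ pos s (p₂ + k₂)) (deleteAt (pos s (p₁ + k₁) ⊔ pos s (p₂ + k₂)) s))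
deleteOneAndTwo {i₁ = i₁} {i₂} s negOrientable w≡4 i₁≡1 i₂≡2 occ₁ occ₂ k₁<n k₂<n =
  let negOrientable″ , u″ , m-2≤M = deleteTwo s (s≤s (s≤s z≤n)) negOrientable i₁≢i₂ occ₁ occ₂ k₁<n k₂<n
        (subst (_≤ 6) (sym i₁+i₂≡3) (s≤s (s≤s (s≤s z≤n))))
        (isUnit-residue w≡4 i₁+i₂≡3 (from-yes (coprime? 1 6)))
  in negOrientable″ , u″ , (λ 6≢6 → contradiction refl 6≢6) , (λ _ → m-2≤M)
  where
  i₁+i₂≡3 : toℕ i₁ + toℕ i₂ ≡ 3
  i₁+i₂≡3 = cong₂ _+_ i₁≡1 i₂≡2
  i₁≢i₂ : i₁ ≢ i₂
  i₁≢i₂ i₁≡i₂ = contradiction (trans (sym i₁≡1) (trans (cong toℕ i₁≡i₂) i₂≡2)) λ ()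

lemma12 : (q : ℕ) .{{_ : NonZero q}} → 2 < q → (n : ℕ) (s : List (Fin q)) →
    IsNegOrientable n s →
    (∀ (i : Fin q) → 1 ≤ toℕ i → 2 * toℕ i < q → ∃ λ p → OccursAt n s p (replicate n i)) →
    (s' : List (Fin q)) → Obtained q n s s' →
    IsNegOrientable n s' × IsUnit q (weight s') ×
    (q ≢ 6 → length s ∸ 1 ≤ length s') × (q ≡ 6 → length s ∸ 2 ≤ length s')
lemma12 q 2<q n s negOrientable _ .s (unit u) =
  negOrientable , u , (λ _ → m∸n≤m (length s) 1) , (λ _ → m∸n≤m (length s) 2)
lemma12 q 2<q n s negOrientable _ _ (notSix _ _ i _ _ u p k k<n occ) =
  deleteOne s (<⇒≤ 2<q) negOrientable occ k<n u
lemma12 q 2<q n s negOrientable _ _ (six02 refl (inj₁ w≡0) i i≡1 p k k<n occ) =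
  deleteOne s (<⇒≤ 2<q) negOrientable occ k<n (isUnit-residue w≡0 i≡1 (from-yes (coprime? 5 6)))
lemma12 q 2<q n s negOrientable _ _ (six02 refl (inj₂ w≡2) i i≡1 p k k<n occ) =
  deleteOne s (<⇒≤ 2<q) negOrientable occ k<n (isUnit-residue w≡2 i≡1 (from-yes (coprime? 1 6)))
lemma12 q 2<q n s negOrientable _ _ (six3 refl w≡3 i i≡2 p k k<n occ) =
  deleteOne s (<⇒≤ 2<q) negOrientable occ k<n (isUnit-residue w≡3 i≡2 (from-yes (coprime? 1 6)))
lemma12 q 2<q n s negOrientable _ _ (six4 refl w≡4 i₁ i₂ i₁≡1 i₂≡2 p₁ k₁ p₂ k₂ k₁<n k₂<n occ₁ occ₂) =
  deleteOneAndTwo s negOrientable w≡4 i₁≡1 i₂≡2 occ₁ occ₂ k₁<n k₂<n
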